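{- Let $\ell\ge 2$ be an integer, let $G$ be a $C_{\ell+1}$-free graph and let $v$ be any vertex of $G$. Then $G[N(v)]$ is $(\ell-2)$-degenerate.
   Context: $C_{\ell+1}$-free means $G$ contains no cycle of length exactly $\ell+1$ as a subgraph. $N(v)$ is the open neighbourhood of $v$. A graph is $k$-degenerate if every non-empty subgraph has a vertex of degree at most $k$ in that subgraph. -}

module Defs where

open import Data.Nat using (ℕ; zero; suc; _≤_)
open import Data.Fin using (Fin; zero; suc; inject₁; fromℕ)
open import Data.Bool using (Bool; true; false; _∧_; if_then_else_)
open import Data.List using (List; map; allFin)
open import Data.Nat.ListAction using (sum)
open import Data.Empty using (⊥)
open import Data.Product using (Σ; ∃; _×_)
open import Relation.Binary.PropositionalEquality using (_≡_)
open import Function.Definitions using (Injective)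

record Graph (n : ℕ) : Set where
  field
    adj    : Fin n → Fin n → Bool
    sym    : ∀ u w → adj u w ≡ adj w u
    irrefl : ∀ u → adj u u ≡ false
open Graph public

record Sub (n : ℕ) : Set where
  field
    V : Fin n → Bool
    E : Fin n → Fin n → Bool
open Sub public

record _⊑_ {n : ℕ} (H' H : Sub n) : Set where
  field
    V⊆    : ∀ u → V H' u ≡ true → V H u ≡ true
    E⊆    : ∀ u w → E H' u w ≡ true → E H u w ≡ true
    ends  : ∀ u w → E H' u w ≡ true → (V H' u ≡ true) × (V H' w ≡ true)
    E-sym : ∀ u w → E H' u w ≡ E H' w u

induced : ∀ {n} → Graph n → (Fin n → Bool) → Sub n
induced G S = record { V = S ; E = λ u w → S u ∧ (S w ∧ adj G u w) }

N : ∀ {n} → Graph n → Fin n → Fin n → Bool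
N G v u = adj G v u

deg : ∀ {n} → Sub n → Fin n → ℕ
deg {n} H u = sum (map (λ w → if E H u w then 1 else 0) (allFin n))

Degenerate : ∀ {n} → ℕ → Sub n → Set
Degenerate {n} k H =
  (H' : Sub n) → H' ⊑ H → (∃ λ u → V H' u ≡ true) →
  ∃ λ u → (V H' u ≡ true) × (deg H' u ≤ k)

-- G contains a cycle of length (suc m) (m ≥ 2 intended) as a subgraph:
-- distinct vertices c 0, …, c m with c i ~ c (i+1) and c m ~ c 0.
HasCycle : ∀ {n} → Graph n → ℕ → Set
HasCycle {n} G zero = ⊥
HasCycle {n} G (suc m) =
  Σ (Fin (suc m) → Fin n) λ c →
    Injective _≡_ _≡_ c ×
    ((i : Fin m) → adj G (c (inject₁ i)) (c (suc i)) ≡ true) ×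
    (adj G (c (fromℕ m)) (c zero) ≡ true)

{-# OPTIONS --safe #-}
module Submission where

-- Let H be a non-empty subgraph of G[N(v)]. Grow a path in H greedily at its head. If the
-- path gets stuck before it has ℓ vertices, every neighbour of the head already lies on the
-- path, so the head has degree at most ℓ - 2. Otherwise the ℓ path vertices, all adjacent
-- to v, close through v into a cycle of length ℓ + 1.

open import Defs
open import Data.Nat using (ℕ; zero; suc; _+_; _≤_; _∸_; z≤n; s≤s)
open import Data.Nat.Properties using (≤-refl; ≤-reflexive; ≤-trans; +-monoˡ-≤; +-monoʳ-≤; +-suc; m≤n⇒m≤1+n; module ≤-Reasoning)
open import Data.Fin using (Fin; zero; suc; inject₁; fromℕ)
open import Data.Fin.Properties using (any?; ¬Fin0; suc-injective) renaming (_≟_ to _≟ᶠ_)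
open import Data.Bool using (Bool; true; false; if_then_else_)
open import Data.Bool.Properties using (∧-conicalʳ) renaming (_≟_ to _≟ᵇ_)
open import Data.List using (tabulate)
open import Data.List.Properties using (map-tabulate)
open import Data.Nat.ListAction using (sum)
open import Data.Vec.Functional using (_∷_)
open import Data.Empty using (⊥-elim)
open import Data.Product using (∃; _×_; _,_; proj₁; proj₂)
open import Data.Sum using (_⊎_; inj₁; inj₂)
open import Function using (_∘_; id)
open import Function.Definitions using (Injective)
open import Relation.Nullary using (¬_; yes; no)
open import Relation.Nullary.Decidable using (_×-dec_; ¬?)
open import Relation.Binary.PropositionalEquality as ≡ using (_≡_; _≢_; refl; cong)

count : ∀ {n} → (Fin n → Bool) → ℕ
count f = sum (tabulate (λ w → if f w then 1 else 0))

deg≡count : ∀ {n} (H : Sub n) u → deg H u ≡ count (E H u)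
deg≡count H u = cong sum (map-tabulate id (λ w → if E H u w then 1 else 0))

delete : ∀ {n} → Fin n → (Fin n → Bool) → Fin n → Bool
delete zero    f zero    = false
delete zero    f (suc w) = f (suc w)
delete (suc a) f zero    = f zero
delete (suc a) f (suc w) = delete a (f ∘ suc) w

delete-sound : ∀ {n} a (f : Fin n → Bool) w → delete a f w ≡ true → f w ≡ true × w ≢ a
delete-sound zero    f (suc w) fw = fw , λ ()
delete-sound (suc a) f zero    fw = fw , λ ()
delete-sound (suc a) f (suc w) e  with delete-sound a (f ∘ suc) w e
... | fw , w≢a = fw , w≢a ∘ suc-injective

indicator≤1 : ∀ b → (if b then 1 else 0) ≤ 1
indicator≤1 true  = ≤-refl
indicator≤1 false = z≤n

count≤suc-count-delete : ∀ {n} a (f : Fin n → Bool) → count f ≤ suc (count (delete a f))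
count≤suc-count-delete zero    f = +-monoˡ-≤ (count (f ∘ suc)) (indicator≤1 (f zero))
count≤suc-count-delete (suc a) f = begin
  b + count (f ∘ suc)                    ≤⟨ +-monoʳ-≤ b (count≤suc-count-delete a (f ∘ suc)) ⟩
  b + suc (count (delete a (f ∘ suc)))   ≡⟨ +-suc b _ ⟩
  suc (b + count (delete a (f ∘ suc)))   ∎
  where
  open ≤-Reasoning
  b = if f zero then 1 else 0

count-none : ∀ {n} (f : Fin n → Bool) → (∀ w → f w ≢ true) → count f ≡ 0
count-none {zero}  f none = refl
count-none {suc n} f none with f zero in f0
... | true  = ⊥-elim (none zero f0)
... | false = count-none (f ∘ suc) (none ∘ suc)

count≤cover : ∀ {n k} (f : Fin n → Bool) (g : Fin k → Fin n) →
  (∀ w → f w ≡ true → ∃ λ i → g i ≡ w) → count f ≤ k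
count≤cover {k = zero} f g covered =
  ≤-reflexive (count-none f (λ w fw → ¬Fin0 (proj₁ (covered w fw))))
count≤cover {k = suc k} f g covered =
  ≤-trans (count≤suc-count-delete (g zero) f)
          (s≤s (count≤cover (delete (g zero) f) (g ∘ suc) covered′))
  where
  covered′ : ∀ w → delete (g zero) f w ≡ true → ∃ λ i → g (suc i) ≡ w
  covered′ w e with delete-sound (g zero) f w e
  ... | fw , w≢g₀ with covered w fw
  ...   | zero  , g₀≡w = ⊥-elim (w≢g₀ (≡.sym g₀≡w))
  ...   | suc i , gᵢ≡w = i , gᵢ≡w

∷-injective : ∀ {n k} {x : Fin n} {xs : Fin k → Fin n} →
  Injective _≡_ _≡_ xs → (∀ i → xs i ≢ x) → Injective _≡_ _≡_ (x ∷ xs)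
∷-injective inj x∉xs {zero}  {zero}  _  = refl
∷-injective inj x∉xs {zero}  {suc j} eq = ⊥-elim (x∉xs j (≡.sym eq))
∷-injective inj x∉xs {suc i} {zero}  eq = ⊥-elim (x∉xs i eq)
∷-injective inj x∉xs {suc i} {suc j} eq = cong suc (inj eq)

induced-adj : ∀ {n} (G : Graph n) S {u w} → E (induced G S) u w ≡ true → adj G u w ≡ true
induced-adj G S {u} {w} e = ∧-conicalʳ (S w) _ (∧-conicalʳ (S u) _ e)

adj-irrefl : ∀ {n} (G : Graph n) u → adj G u u ≢ true
adj-irrefl G u e with () ← ≡.trans (≡.sym (irrefl G u)) e

⊑induced⇒loopless : ∀ {n} (G : Graph n) S {H} → H ⊑ induced G S → ∀ u → E H u u ≢ true
⊑induced⇒loopless G S H⊑G[S] u = adj-irrefl G u ∘ induced-adj G S ∘ _⊑_.E⊆ H⊑G[S] u u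

record Path {n} (H : Sub n) (k : ℕ) : Set where
  field
    vertex    : Fin (suc k) → Fin n
    injective : Injective _≡_ _≡_ vertex
    inV       : ∀ i → V H (vertex i) ≡ true
    edge      : ∀ (i : Fin k) → E H (vertex (inject₁ i)) (vertex (suc i)) ≡ true

Path-⊑ : ∀ {n k} {H K : Sub n} → H ⊑ K → Path H k → Path K k
Path-⊑ H⊑K P = record
  { vertex = vertex ; injective = injective ; inV = V⊆ _ ∘ inV ; edge = λ i → E⊆ _ _ (edge i) }
  where open Path P ; open _⊑_ H⊑K

LowDegreeVertex : ∀ {n} → ℕ → Sub n → Set
LowDegreeVertex d H = ∃ λ u → (V H u ≡ true) × (deg H u ≤ d)

module _ {n} (G : Graph n) (S : Fin n → Bool) {H : Sub n} (H⊑G[S] : H ⊑ induced G S) where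
  open _⊑_ H⊑G[S]

  singletonPath : ∀ {u} → V H u ≡ true → Path H 0
  singletonPath {u} u∈H = record
    { vertex = λ _ → u ; injective = λ { {zero} {zero} _ → refl } ; inV = λ _ → u∈H ; edge = λ () }

  prepend : ∀ {k} (P : Path H k) w → E H (Path.vertex P zero) w ≡ true →
    (∀ i → Path.vertex P i ≢ w) → Path H (suc k)
  prepend P w e w∉P = record
    { vertex = w ∷ vertex ; injective = ∷-injective injective w∉P ; inV = inV′ ; edge = edge′ }
    where
    open Path P
    inV′ : ∀ i → V H ((w ∷ vertex) i) ≡ true
    inV′ zero    = proj₂ (ends _ w e)
    inV′ (suc i) = inV i
    edge′ : ∀ i → E H ((w ∷ vertex) (inject₁ i)) ((w ∷ vertex) (suc i)) ≡ true
    edge′ zero    = ≡.trans (E-sym w _) e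
    edge′ (suc i) = edge i

  head-deg≤ : ∀ {k} (P : Path H k) →
    (∀ w → E H (Path.vertex P zero) w ≡ true → ∃ λ i → Path.vertex P i ≡ w) →
    deg H (Path.vertex P zero) ≤ k
  head-deg≤ P onPath = ≤-trans (≤-reflexive (deg≡count H _)) (count≤cover _ (vertex ∘ suc) onTail)
    where
    open Path P
    onTail : ∀ w → E H (vertex zero) w ≡ true → ∃ λ i → vertex (suc i) ≡ w
    onTail w e with onPath w e
    ... | suc i , vᵢ≡w = i , vᵢ≡w
    ... | zero  , v₀≡w =
      ⊥-elim (⊑induced⇒loopless G S H⊑G[S] w (≡.subst (λ u → E H u w ≡ true) v₀≡w e))

  extendPath : ∀ {d k} → k ≤ d → Path H k → LowDegreeVertex d H ⊎ Path H (suc k)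
  extendPath k≤d P
    with any? (λ w → (E H (vertex zero) w ≟ᵇ true) ×-dec ¬? (any? (λ i → vertex i ≟ᶠ w)))
    where open Path P
  ... | yes (w , e , w∉P) = inj₂ (prepend P w e (λ i vᵢ≡w → w∉P (i , vᵢ≡w)))
  ... | no stuck = inj₁ (vertex zero , inV zero , ≤-trans (head-deg≤ P onPath) k≤d)
    where
    open Path P
    onPath : ∀ w → E H (vertex zero) w ≡ true → ∃ λ i → vertex i ≡ w
    onPath w e with any? (λ i → vertex i ≟ᶠ w)
    ... | yes w∈P = w∈P
    ... | no  w∉P = ⊥-elim (stuck (w , e , w∉P))

  pathOrLowDegree : ∀ {d} k → k ≤ suc d → (∃ λ u → V H u ≡ true) → LowDegreeVertex d H ⊎ Path H k
  pathOrLowDegree zero    _         (u , u∈H) = inj₂ (singletonPath u∈H)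
  pathOrLowDegree (suc k) (s≤s k≤d) nonempty with pathOrLowDegree k (m≤n⇒m≤1+n k≤d) nonempty
  ... | inj₁ low = inj₁ low
  ... | inj₂ P   = extendPath k≤d P

coneCycle : ∀ {n k} (G : Graph n) v → Path (induced G (N G v)) k → HasCycle G (suc (suc k))
coneCycle {k = k} G v P = v ∷ vertex , ∷-injective injective v∉P , edge′ , closing
  where
  open Path P
  v∉P : ∀ i → vertex i ≢ v
  v∉P i vᵢ≡v = adj-irrefl G v (≡.subst (λ u → adj G v u ≡ true) vᵢ≡v (inV i))
  edge′ : ∀ (i : Fin (suc k)) → adj G ((v ∷ vertex) (inject₁ i)) ((v ∷ vertex) (suc i)) ≡ true
  edge′ zero    = inV zero
  edge′ (suc i) = induced-adj G (N G v) (edge i)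
  closing : adj G (vertex (fromℕ k)) v ≡ true
  closing = ≡.trans (sym G _ v) (inV (fromℕ k))

proposition2p2 : (ℓ : ℕ) → 2 ≤ ℓ → (n : ℕ) (G : Graph n) →
    ¬ HasCycle G (suc ℓ) → (v : Fin n) →
    Degenerate (ℓ ∸ 2) (induced G (N G v))
proposition2p2 (suc (suc d)) (s≤s (s≤s z≤n)) n G noCycle v H H⊑G[N[v]] nonempty
  with pathOrLowDegree G (N G v) H⊑G[N[v]] (suc d) ≤-refl nonempty
... | inj₁ low = low
... | inj₂ P   = ⊥-elim (noCycle (coneCycle G v (Path-⊑ H⊑G[N[v]] P)))
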